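{- Let $(T,w)$ be a weighted tree with $w(T)=n$. Then there is a path $P$ in $T$ with endpoints $c_1$ and $c_2$ such that every centroid of $(T,w)$ is a vertex of $P$ and $w(T_P)=0$. Moreover, if $P$ is non-trivial (i.e., $c_1\neq c_2$), then $\mathrm{hs}(c_1)=\mathrm{hs}(c_2)=w(T_{c_1,P})=w(T_{c_2,P})=n/2$; otherwise $P$ is a trivial path consisting of one vertex $c$ with $\mathrm{hs}(c)<n/2$.
   Context: A weighted tree is a pair $(T,w)$ where $T$ is a finite tree and $w$ is a non-negative integer weight function on its vertices such that at least one vertex has strictly positive weight. For $U\subseteq V(T)$, $w(U)=\sum_{u\in U}w(u)$, and for a subtree $T'$, $w(T')=w(V(T'))$; $w(T)$ is the total weight. The subtrees of a vertex $v$ are the connected components of $T-v$. The heaviest subtree weight $\mathrm{hs}(v)$ of $v$ is the maximum weight of a subtree of $v$, and $\mathrm{hs}(v)=0$ if $v$ is the only vertex of $T$. A centroid of $(T,w)$ is a vertex minimizing $\mathrm{hs}$. For a non-trivial path $P$ in $T$ and a vertex $v$ of $P$, $T_{v,P}$ denotes the maximal subtree of $T$ containing $v$ but no other vertex of $P$; $T_P$ denotes the maximal subtree of $T$ containing all internal vertices of $P$ but not its endpoints ($T_P$ is empty, of weight $0$, if $P$ has no internal vertices or is trivial). -}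

module Defs where

open import Data.Nat using (ℕ; zero; suc; _+_; _*_; _≤_; _<_)
open import Data.Fin using (Fin)
open import Data.Bool using (Bool; true; false; if_then_else_)
open import Data.Maybe using (Maybe; just)
open import Data.List using (List; []; _∷_; head; last; length; map; allFin)
open import Data.Nat.ListAction using (sum)
open import Data.List.Membership.Propositional using (_∈_; _∉_)
open import Data.List.Relation.Unary.Linked using (Linked)
open import Data.List.Relation.Unary.Unique.Propositional using (Unique)
open import Data.Product using (Σ; ∃; ∃-syntax; _×_; _,_)
open import Data.Sum using (_⊎_)
open import Relation.Binary.PropositionalEquality using (_≡_; _≢_)
open import Relation.Nullary using (¬_)

-- Vertices of a (finite) graph are Fin m; the edge relation is E.
-- Vertex subsets are Boolean predicates, so that their weight is a finite sum.

VSet : ℕ → Set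
VSet m = Fin m → Bool

weight : ∀ {m} → (Fin m → ℕ) → VSet m → ℕ
weight {m} w U = sum (map (λ i → if U i then w i else 0) (allFin m))

totalWeight : ∀ {m} → (Fin m → ℕ) → ℕ
totalWeight w = weight w (λ _ → true)

module _ {m : ℕ} (E : Fin m → Fin m → Set) where

  IsPath : Fin m → Fin m → List (Fin m) → Set
  IsPath a b xs = Linked E xs × Unique xs × head xs ≡ just a × last xs ≡ just b

  HasCycle : Set
  HasCycle = ∃[ a ] ∃[ b ] ∃[ xs ] (IsPath a b xs × 3 ≤ length xs × E b a)

  record IsTree : Set where
    field
      nonempty   : 0 < m
      symmetric  : ∀ {a b} → E a b → E b a
      irreflexive : ∀ a → ¬ E a a
      connected  : ∀ a b → ∃[ xs ] IsPath a b xs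
      acyclic    : ¬ HasCycle

  -- S is (the vertex set of) the connected component of T - v containing u (u ≠ v),
  -- i.e. one of the subtrees of v.
  IsSubtreeOf : Fin m → Fin m → VSet m → Set
  IsSubtreeOf v u S =
    u ≢ v × (∀ x → (S x ≡ true → ∃[ xs ] (IsPath u x xs × v ∉ xs))
                 × (∃[ xs ] (IsPath u x xs × v ∉ xs) → S x ≡ true))

  module _ (w : Fin m → ℕ) where

    -- HS v h : h = hs(v), the maximum weight of a subtree of v
    -- (h = 0 if v is the only vertex of T).
    HS : Fin m → ℕ → Set
    HS v h =
      (∀ u S → IsSubtreeOf v u S → weight w S ≤ h)
      × ((∃[ u ] ∃[ S ] (IsSubtreeOf v u S × weight w S ≡ h))
         ⊎ ((∀ u → u ≡ v) × h ≡ 0))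

    IsCentroid : Fin m → Set
    IsCentroid c = ∃[ h ] (HS c h × (∀ v h' → HS v h' → h ≤ h'))

  -- For a path P and a vertex v on P: S = T_{v,P}, the maximal subtree containing v
  -- but no other vertex of P.
  IsTvP : List (Fin m) → Fin m → VSet m → Set
  IsTvP P v S =
    ∀ x → (S x ≡ true → ∃[ xs ] (IsPath v x xs × (∀ y → y ∈ xs → y ∈ P → y ≡ v)))
        × (∃[ xs ] (IsPath v x xs × (∀ y → y ∈ xs → y ∈ P → y ≡ v)) → S x ≡ true)

  -- For a path P with endpoints c₁, c₂: S = T_P, the maximal subtree containing all
  -- internal vertices of P but not its endpoints (empty if P has no internal vertex).
  ReachInterior : List (Fin m) → Fin m → Fin m → Fin m → Set
  ReachInterior P c₁ c₂ x =
    ∃[ i ] (i ∈ P × i ≢ c₁ × i ≢ c₂ × ∃[ xs ] (IsPath i x xs × c₁ ∉ xs × c₂ ∉ xs))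

  IsTP : List (Fin m) → Fin m → Fin m → VSet m → Set
  IsTP P c₁ c₂ S =
    ∀ x → (S x ≡ true → ReachInterior P c₁ c₂ x)
        × (ReachInterior P c₁ c₂ x → S x ≡ true)

{-# OPTIONS --safe #-}
module Submission where

-- Call c balanced if every branch of c (component of T - c) weighs at most n/2; one exists, found
-- by descending towards heavy branches. Since hs(v) + hs(c) ≥ n whenever v ≠ c, a balanced c with
-- hs(c) < n/2 is the only centroid. Otherwise the centroids are exactly the vertices with hs = n/2,
-- and there are at least two of them (the neighbour of such a vertex towards its heaviest branch is
-- another). For two of them, c₁ and c₂, as far apart as possible, every centroid lies on the path P
-- between them. The branch of c₁ containing c₂ and the branch of c₂ containing c₁ both weigh n/2 and
-- together cover T, so their intersection, which contains T_P, weighs 0; and T_{c₁,P} lies in the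
-- second while its complement lies in the first, so it weighs exactly n/2.

open import Defs
open import Data.Nat using (ℕ; _+_; _*_; _≤_; _<_; _<?_; z≤n; s≤s)
import Data.Nat as ℕ
open import Data.Nat.Properties
  using ( ≤-refl; ≤-trans; ≤-antisym; ≤-reflexive; <-irrefl; ≮⇒≥; <⇒≱; <⇒≤; n≤0⇒n≡0
        ; m≤n⇒m<n∨m≡n; m<m+n; m≤m+n; ≤-totalPreorder; +-commutativeSemigroup
        ; +-comm; +-identityʳ; +-cancelˡ-≡; +-cancelʳ-≤; +-cancelʳ-<
        ; +-mono-≤; +-monoˡ-≤; +-monoʳ-≤; +-monoʳ-<; +-mono-<-≤; +-mono-≤-<
        ; *-monoʳ-≤; *-distribˡ-+; *-cancelˡ-≡ )
open import Algebra.Properties.CommutativeSemigroup +-commutativeSemigroup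
  using () renaming (interchange to +-interchange)
open import Data.Nat.ListAction using (sum)
open import Data.Fin using (Fin)
open import Data.Fin.Properties using (_≟_)
open import Function using (_∘_; case_of_; mk⇔)
open import Data.Bool using (true; false; not; _∧_; _∨_; if_then_else_)
open import Data.Bool.Properties using (∨-inverseʳ; ∧-inverseʳ; ⇔→≡)
open import Data.List
  using (List; []; _∷_; [_]; _++_; _∷ʳ_; head; last; length; map; reverse; allFin; cartesianProduct)
open import Data.Maybe using (just)
open import Data.List.Relation.Unary.Linked using (Linked; [-]; _∷_)
open import Data.List.Properties using (unfold-reverse; reverse-++; length-reverse; length-++; ++-assoc; map-cong)
open import Data.List.Relation.Unary.Any as Any using (Any; here; there)
open import Data.List.Relation.Unary.Any.Properties using (reverse⁺; reverse⁻; singleton⁻)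
open import Data.List.Relation.Unary.All as All using (All; []; _∷_)
import Data.List.Relation.Unary.All.Properties as All
open import Data.List.Relation.Unary.Unique.Propositional using (Unique; []; _∷_)
open import Data.List.Relation.Unary.Unique.Propositional.Properties using (++⁺)
open import Data.List.Relation.Binary.Disjoint.Propositional using (Disjoint)
open import Data.List.Membership.Propositional using (_∈_; _∉_; find; lose)
import Data.List.Relation.Unary.First as First
open import Data.List.Relation.Unary.First.Properties using (toView)
open import Data.List.Membership.Propositional.Properties
  using (∈-allFin; ∈-cartesianProduct⁺; ∈-∃++; ∈-++⁺ˡ; ∈-++⁺ʳ; ∈-++⁻)
open import Data.Product as Product using (Σ; ∃; ∃₂; ∃-syntax; _×_; _,_; proj₁; proj₂)
open import Data.Sum as Sum using (_⊎_; inj₁; inj₂)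
open import Data.Empty using (⊥; ⊥-elim)
open import Relation.Nullary using (¬_; ¬?; Dec; yes; no; does; toSum; _×-dec_; _→-dec_)
open import Relation.Nullary.Decidable using (dec-true; dec-false; decidable-stable)
open import Relation.Unary using (Decidable)
open import Relation.Binary using (TotalPreorder)
import Relation.Binary.Construct.Flip.EqAndOrd as Flip
open import Relation.Binary.PropositionalEquality
  using (_≡_; _≢_; refl; sym; trans; cong; cong₂; subst; subst₂; module ≡-Reasoning)
open import Level using (0ℓ)

module _ {A : Set} where

  Unique-++⁻ : ∀ xs {ys : List A} → Unique (xs ++ ys) → Unique xs × Unique ys × Disjoint xs ys
  Unique-++⁻ [] u = [] , u , λ ()
  Unique-++⁻ (x ∷ xs) (x∉ ∷ u) with uxs , uys , xs#ys ← Unique-++⁻ xs u =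
    All.++⁻ˡ xs x∉ ∷ uxs , uys , λ where
      (here refl , v∈ys) → All.lookup (All.++⁻ʳ xs x∉) v∈ys refl
      (there v∈xs , v∈ys) → xs#ys (v∈xs , v∈ys)

  Unique-prefix : ∀ pre {z : A} {post} → Unique (pre ++ z ∷ post) → Unique (pre ∷ʳ z)
  Unique-prefix pre {z} {post} u = proj₁ (Unique-++⁻ (pre ∷ʳ z) (subst Unique (sym (++-assoc pre [ z ] post)) u))

  ∈-prefix : ∀ pre {z t : A} {post} → t ∈ pre ∷ʳ z → t ∈ pre ++ z ∷ post
  ∈-prefix pre {z} {post = post} t∈ = subst (_ ∈_) (++-assoc pre [ z ] post) (∈-++⁺ˡ t∈)

  Unique-split : ∀ pre {z t : A} {post} → Unique (pre ++ z ∷ post) → t ∈ pre ∷ʳ z → t ∈ z ∷ post → t ≡ z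
  Unique-split pre u t∈pre-z t∈z-post with ∈-++⁻ pre t∈pre-z
  ... | inj₁ t∈pre = ⊥-elim (proj₂ (proj₂ (Unique-++⁻ pre u)) (t∈pre , t∈z-post))
  ... | inj₂ (here t≡z) = t≡z

  Unique-reverse : ∀ {xs : List A} → Unique xs → Unique (reverse xs)
  Unique-reverse {[]} [] = []
  Unique-reverse {x ∷ xs} (x∉ ∷ u) rewrite unfold-reverse x xs =
    ++⁺ (Unique-reverse u) ([] ∷ []) λ { (v∈ , here refl) → All.lookup x∉ (reverse⁻ v∈) refl }

module _ {A : Set} (O : TotalPreorder 0ℓ 0ℓ 0ℓ) where
  open TotalPreorder O using (_≲_; total) renaming (Carrier to B; refl to ≲-refl; trans to ≲-trans)

  extremum : (f : A → B) {P : A → Set} → Decidable P → ∀ xs →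
             (∃ λ b → P b × ∀ {y} → y ∈ xs → P y → f b ≲ f y) ⊎ (∀ {y} → y ∈ xs → ¬ P y)
  extremum f P? [] = inj₂ λ ()
  extremum f P? (x ∷ xs) with P? x | extremum f P? xs
  ... | no ¬px | inj₂ none = inj₂ λ { (here refl) → ¬px ; (there y∈) → none y∈ }
  ... | no ¬px | inj₁ (b , pb , opt) =
    inj₁ (b , pb , λ { (here refl) px → ⊥-elim (¬px px) ; (there y∈) → opt y∈ })
  ... | yes px | inj₂ none =
    inj₁ (x , px , λ { (here refl) _ → ≲-refl ; (there y∈) py → ⊥-elim (none y∈ py) })
  ... | yes px | inj₁ (b , pb , opt) with total (f x) (f b)
  ...   | inj₁ x≲b = inj₁ (x , px , λ { (here refl) _ → ≲-refl ; (there y∈) py → ≲-trans x≲b (opt y∈ py) })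
  ...   | inj₂ b≲x = inj₁ (b , pb , λ { (here refl) _ → b≲x ; (there y∈) → opt y∈ })

module _ {A : Set} where

  sum-map-mono : ∀ xs {f g : A → ℕ} → (∀ x → f x ≤ g x) → sum (map f xs) ≤ sum (map g xs)
  sum-map-mono [] f≤g = z≤n
  sum-map-mono (x ∷ xs) f≤g = +-mono-≤ (f≤g x) (sum-map-mono xs f≤g)

  sum-map-< : ∀ {xs x} {f g : A → ℕ} → x ∈ xs → (∀ y → f y ≤ g y) → f x < g x →
              sum (map f xs) < sum (map g xs)
  sum-map-< {_ ∷ xs} (here refl) f≤g fx<gx = +-mono-<-≤ fx<gx (sum-map-mono xs f≤g)
  sum-map-< {y ∷ _} (there x∈) f≤g fx<gx = +-mono-≤-< (f≤g y) (sum-map-< x∈ f≤g fx<gx)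

  sum-map-+ : ∀ xs {f g : A → ℕ} → sum (map f xs) + sum (map g xs) ≡ sum (map (λ x → f x + g x) xs)
  sum-map-+ [] = refl
  sum-map-+ (x ∷ xs) {f} {g} = trans (+-interchange (f x) _ (g x) _) (cong (f x + g x +_) (sum-map-+ xs))

  sum-map-0 : ∀ xs {f : A → ℕ} → (∀ x → f x ≡ 0) → sum (map f xs) ≡ 0
  sum-map-0 [] f≡0 = refl
  sum-map-0 (x ∷ xs) f≡0 rewrite f≡0 x = sum-map-0 xs f≡0

module _ {m : ℕ} where

  infix 4 _⊆_
  infixr 6 _∪_
  infixr 7 _∩_

  _⊆_ : VSet m → VSet m → Set
  S ⊆ S′ = ∀ x → S x ≡ true → S′ x ≡ true

  _∪_ _∩_ : VSet m → VSet m → VSet m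
  (S ∪ S′) x = S x ∨ S′ x
  (S ∩ S′) x = S x ∧ S′ x

  ∁ : VSet m → VSet m
  ∁ S x = not (S x)

  ⟦_⟧ : {P : Fin m → Set} → Decidable P → VSet m
  ⟦ P? ⟧ x = does (P? x)

  ∩-intro : ∀ {S S′ : VSet m} {x} → S x ≡ true → S′ x ≡ true → (S ∩ S′) x ≡ true
  ∩-intro Sx S′x rewrite Sx | S′x = refl

  ∪-intro : ∀ {S S′ : VSet m} {x} → S x ≡ true ⊎ S′ x ≡ true → (S ∪ S′) x ≡ true
  ∪-intro {S} {S′} {x} S⊎S′ with S x | S′ x
  ... | true | _ = refl
  ... | false | true = refl
  ... | false | false = Sum.[ (λ ()) , (λ ()) ] S⊎S′

  ∩-empty : ∀ {S S′ : VSet m} {x} → (S x ≡ true → S′ x ≡ true → ⊥) → (S ∩ S′) x ≡ false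
  ∩-empty {S} {S′} {x} disjoint with S x | S′ x
  ... | true | true = ⊥-elim (disjoint refl refl)
  ... | true | false = refl
  ... | false | _ = refl

  ∪-⊆ : ∀ {S S′ U : VSet m} → S ⊆ U → S′ ⊆ U → S ∪ S′ ⊆ U
  ∪-⊆ {S} S⊆U S′⊆U x S∪S′x with S x in Sx
  ... | true = S⊆U x Sx
  ... | false = S′⊆U x S∪S′x

  ∈⟦⟧⁻ : ∀ {P : Fin m → Set} (P? : Decidable P) {x} → ⟦ P? ⟧ x ≡ true → P x
  ∈⟦⟧⁻ P? {x} eq with P? x
  ... | yes px = px

  ∈⟦⟧⁺ : ∀ {P : Fin m → Set} (P? : Decidable P) {x} → P x → ⟦ P? ⟧ x ≡ true
  ∈⟦⟧⁺ P? {x} = dec-true (P? x)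

module Weight {m : ℕ} (w : Fin m → ℕ) where

  private
    restrict : VSet m → Fin m → ℕ
    restrict S i = if S i then w i else 0

    restrict-mono : ∀ {S S′} → S ⊆ S′ → ∀ i → restrict S i ≤ restrict S′ i
    restrict-mono {S} S⊆S′ i with S i in Si
    ... | false = z≤n
    ... | true rewrite S⊆S′ i Si = ≤-refl

  weight-cong : ∀ {S S′} → (∀ x → S x ≡ S′ x) → weight w S ≡ weight w S′
  weight-cong S≗S′ = cong sum (map-cong (λ i → cong (if_then w i else 0) (S≗S′ i)) (allFin m))

  weight-mono : ∀ {S S′} → S ⊆ S′ → weight w S ≤ weight w S′
  weight-mono S⊆S′ = sum-map-mono (allFin m) (restrict-mono S⊆S′)

  weight-⊂ : ∀ {S S′} x → S ⊆ S′ → S′ x ≡ true → S x ≡ false → 0 < w x → weight w S < weight w S′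
  weight-⊂ {S} {S′} x S⊆S′ S′x Sx wx>0 =
    sum-map-< (∈-allFin x) (restrict-mono S⊆S′) (subst₂ _<_ (cong (if_then w x else 0) (sym Sx))
                                                           (cong (if_then w x else 0) (sym S′x)) wx>0)

  weight-∅ : ∀ {S} → (∀ x → S x ≡ false) → weight w S ≡ 0
  weight-∅ S≡∅ = sum-map-0 (allFin m) (λ i → cong (if_then w i else 0) (S≡∅ i))

  weight-∪-∩ : ∀ S S′ → weight w S + weight w S′ ≡ weight w (S ∪ S′) + weight w (S ∩ S′)
  weight-∪-∩ S S′ = trans (sum-map-+ (allFin m))
    (trans (cong sum (map-cong pointwise (allFin m))) (sym (sum-map-+ (allFin m))))
    where
      pointwise : ∀ i → restrict S i + restrict S′ i ≡ restrict (S ∪ S′) i + restrict (S ∩ S′) i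
      pointwise i with S i | S′ i
      ... | true  | true  = refl
      ... | true  | false = refl
      ... | false | true  = sym (+-identityʳ (w i))
      ... | false | false = refl

  weight-disjoint-∪ : ∀ {S S′} → (∀ x → S x ≡ true → S′ x ≡ true → ⊥) →
                      weight w S + weight w S′ ≡ weight w (S ∪ S′)
  weight-disjoint-∪ {S} {S′} disjoint = begin
    weight w S + weight w S′                ≡⟨ weight-∪-∩ S S′ ⟩
    weight w (S ∪ S′) + weight w (S ∩ S′)   ≡⟨ cong (weight w (S ∪ S′) +_)
                                                    (weight-∅ (λ x → ∩-empty {S = S} {S′} (disjoint x))) ⟩
    weight w (S ∪ S′) + 0                   ≡⟨ +-identityʳ _ ⟩
    weight w (S ∪ S′)                       ∎
    where open ≡-Reasoning

  weight-covering : ∀ {S S′} → (∀ x → S x ≡ true ⊎ S′ x ≡ true) →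
                    weight w S + weight w S′ ≡ totalWeight w + weight w (S ∩ S′)
  weight-covering {S} {S′} covering =
    trans (weight-∪-∩ S S′)
          (cong (_+ weight w (S ∩ S′)) (weight-cong (λ x → ∪-intro {S = S} {S′} (covering x))))

  totalWeight-positive : ∀ {x} → 0 < w x → 0 < totalWeight w
  totalWeight-positive {x} wx>0 = ≤-trans (s≤s z≤n) (weight-⊂ {S = λ _ → false} x (λ _ ()) refl refl wx>0)

  weight-∁ : ∀ S → weight w S + weight w (∁ S) ≡ totalWeight w
  weight-∁ S = begin
    weight w S + weight w (∁ S)                    ≡⟨ weight-∪-∩ S (∁ S) ⟩
    weight w (S ∪ ∁ S) + weight w (S ∩ ∁ S)        ≡⟨ cong₂ _+_ (weight-cong (λ x → ∨-inverseʳ (S x)))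
                                                                 (weight-∅ (λ x → ∧-inverseʳ (S x))) ⟩
    totalWeight w + 0                              ≡⟨ +-identityʳ _ ⟩
    totalWeight w                                  ∎
    where open ≡-Reasoning

module Halving where
  open Data.Nat.Properties.≤-Reasoning

  private
    2*-≡-+ : ∀ k → 2 * k ≡ k + k
    2*-≡-+ k = cong (k +_) (+-identityʳ k)

  ≤-half : ∀ {n a b} → n ≤ a + b → 2 * b ≤ n → n ≤ 2 * a
  ≤-half {n} {a} {b} n≤a+b 2b≤n = +-cancelʳ-≤ n n (2 * a) (begin
    n + n          ≡⟨ 2*-≡-+ n ⟨
    2 * n          ≤⟨ *-monoʳ-≤ 2 n≤a+b ⟩
    2 * (a + b)    ≡⟨ *-distribˡ-+ 2 a b ⟩
    2 * a + 2 * b  ≤⟨ +-monoʳ-≤ (2 * a) 2b≤n ⟩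
    2 * a + n      ∎)

  half-≤ : ∀ {n a b} → a + b ≤ n → n ≤ 2 * b → 2 * a ≤ n
  half-≤ {n} {a} {b} a+b≤n n≤2b = +-cancelʳ-≤ n (2 * a) n (begin
    2 * a + n      ≤⟨ +-monoʳ-≤ (2 * a) n≤2b ⟩
    2 * a + 2 * b  ≡⟨ *-distribˡ-+ 2 a b ⟨
    2 * (a + b)    ≤⟨ *-monoʳ-≤ 2 a+b≤n ⟩
    2 * n          ≡⟨ 2*-≡-+ n ⟩
    n + n          ∎)

  half-< : ∀ {n a b} → a + b ≤ n → n < 2 * b → 2 * a < n
  half-< {n} {a} {b} a+b≤n n<2b = +-cancelʳ-< n (2 * a) n (begin-strict
    2 * a + n      <⟨ +-monoʳ-< (2 * a) n<2b ⟩
    2 * a + 2 * b  ≡⟨ *-distribˡ-+ 2 a b ⟨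
    2 * (a + b)    ≤⟨ *-monoʳ-≤ 2 a+b≤n ⟩
    2 * n          ≡⟨ 2*-≡-+ n ⟩
    n + n          ∎)

  other-half : ∀ {n a b} → a + b ≡ n → 2 * a ≡ n → 2 * b ≡ n
  other-half {a = a} {b} a+b≡n 2a≡n = ≤-antisym
    (half-≤ {b = a} (≤-reflexive (trans (+-comm b a) a+b≡n)) (≤-reflexive (sym 2a≡n)))
    (≤-half {b = a} (≤-reflexive (sym (trans (+-comm b a) a+b≡n))) (≤-reflexive 2a≡n))

  halves-sum : ∀ {n a b} → 2 * a ≡ n → 2 * b ≡ n → a + b ≡ n
  halves-sum {n} {a} {b} 2a≡n 2b≡n = begin-equality
    a + b  ≡⟨ cong (a +_) (*-cancelˡ-≡ b a 2 (trans 2b≡n (sym 2a≡n))) ⟩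
    a + a  ≡⟨ 2*-≡-+ a ⟨
    2 * a  ≡⟨ 2a≡n ⟩
    n      ∎

  +-squeeze : ∀ {a b s t} → s + t ≡ a + b → s ≤ a → t ≤ b → s ≡ a
  +-squeeze s+t≡a+b s≤a t≤b =
    ≤-antisym s≤a (≮⇒≥ λ s<a → <-irrefl s+t≡a+b (+-mono-<-≤ s<a t≤b))

  more-than-half : ∀ {n a} → 0 < n → n ≤ a → 2 * a ≡ n → ⊥
  more-than-half {n} n>0 n≤a 2a≡n = <⇒≱ (begin-strict
    n      <⟨ m<m+n n n>0 ⟩
    n + n  ≡⟨ 2*-≡-+ n ⟨
    2 * n  ∎) (≤-trans (*-monoʳ-≤ 2 n≤a) (≤-reflexive 2a≡n))

module Tree {m : ℕ} {E : Fin m → Fin m → Set} (tree : IsTree E) where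
  open IsTree tree
  open import Data.List.Membership.DecPropositional (_≟_ {m}) using (_∈?_)

  V : Set
  V = Fin m

  infixr 5 _∷_

  data Walk : V → V → List V → Set where
    end : ∀ {a} → Walk a a (a ∷ [])
    _∷_ : ∀ {a b c xs} → E a b → Walk b c xs → Walk a c (a ∷ xs)

  walk-start : ∀ {a b xs} → Walk a b xs → a ∈ xs
  walk-start end = here refl
  walk-start (_ ∷ _) = here refl

  walk-head : ∀ {a b xs} → Walk a b xs → ∃ λ ys → xs ≡ a ∷ ys
  walk-head end = [] , refl
  walk-head (_ ∷ _) = _ , refl

  walk-end : ∀ {a b xs} → Walk a b xs → b ∈ xs
  walk-end end = here refl
  walk-end (_ ∷ w) = there (walk-end w)

  IsPath⇒Walk : ∀ {a b xs} → IsPath E a b xs → Walk a b xs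
  IsPath⇒Walk {xs = a ∷ ys} (linked , _ , refl , last≡b) = go ys linked last≡b
    where
      go : ∀ {a b} ys → Linked E (a ∷ ys) → last (a ∷ ys) ≡ just b → Walk a b (a ∷ ys)
      go [] _ refl = end
      go (_ ∷ ys) (e ∷ linked) last≡b = e ∷ go ys linked last≡b

  Walk⇒IsPath : ∀ {a b xs} → Walk a b xs → Unique xs → IsPath E a b xs
  Walk⇒IsPath w u = linked w , u , head≡a w , last≡b w
    where
      linked : ∀ {a b xs} → Walk a b xs → Linked E xs
      linked end = [-]
      linked (e ∷ end) = e ∷ [-]
      linked (e ∷ w@(_ ∷ _)) = e ∷ linked w
      head≡a : ∀ {a b xs} → Walk a b xs → head xs ≡ just a
      head≡a end = refl
      head≡a (_ ∷ _) = refl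
      last≡b : ∀ {a b xs} → Walk a b xs → last xs ≡ just b
      last≡b end = refl
      last≡b (e ∷ end) = refl
      last≡b (e ∷ w@(_ ∷ _)) = last≡b w

  _∷ʳʷ_ : ∀ {a b c xs} → Walk a b xs → E b c → Walk a c (xs ∷ʳ c)
  end ∷ʳʷ e = e ∷ end
  (e′ ∷ w) ∷ʳʷ e = e′ ∷ (w ∷ʳʷ e)

  _++ʷ_ : ∀ {a b c xs ys} → Walk a b xs → Walk b c (b ∷ ys) → Walk a c (xs ++ ys)
  end ++ʷ w′ = w′
  (e ∷ w) ++ʷ w′ = e ∷ (w ++ʷ w′)

  reverseʷ : ∀ {a b xs} → Walk a b xs → Walk b a (reverse xs)
  reverseʷ end = end
  reverseʷ {xs = a ∷ xs} (e ∷ w) =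
    subst (Walk _ a) (sym (unfold-reverse a xs)) (reverseʷ w ∷ʳʷ symmetric e)

  splitʷ : ∀ {a b} pre {z post} → Walk a b (pre ++ z ∷ post) → Walk a z (pre ∷ʳ z) × Walk z b (z ∷ post)
  splitʷ [] end = end , end
  splitʷ [] (e ∷ w) = end , e ∷ w
  splitʷ (_ ∷ []) (e ∷ w) = Product.map₁ (e ∷_) (splitʷ [] w)
  splitʷ (_ ∷ x ∷ pre) (e ∷ w) = Product.map₁ (e ∷_) (splitʷ (x ∷ pre) w)

  walk-length : ∀ {a b xs} → Walk a b xs → a ≢ b → 2 ≤ length xs
  walk-length end a≢b = ⊥-elim (a≢b refl)
  walk-length (_ ∷ end) _ = s≤s (s≤s z≤n)
  walk-length (_ ∷ _ ∷ _) _ = s≤s (s≤s z≤n)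

  -- If x ≢ y, the two paths meet again at a first common vertex z, closing a cycle through a.
  second-vertex-unique : ∀ {a x y b p q} → E a x → E a y →
                         Walk x b p → Unique (a ∷ p) → Walk y b q → Unique (a ∷ q) → x ≡ y
  second-vertex-unique {a} {x} {y} {p = p} {q} ax ay wp (a∉p ∷ up) wq (a∉q ∷ uq) with x ≟ y
  ... | yes x≡y = x≡y
  ... | no x≢y with First.first (λ v → Sum.swap (toSum (v ∈? q))) p
  ... | inj₂ p∉q = ⊥-elim (All.lookup p∉q (walk-end wp) (walk-end wq))
  ... | inj₁ first-in-q with toView first-in-q
  ... | First._++_∷_ {pre} {z} pre∉q z∈q post with ∈-∃++ z∈q
  ... | qpre , qpost , refl =
    ⊥-elim (acyclic (a , y , a ∷ cycle , Walk⇒IsPath (ax ∷ x→y) (a∉cycle ∷ u-cycle) ,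
                     s≤s (walk-length x→y x≢y) , symmetric ay))
    where
      x→z : Walk x z (pre ∷ʳ z)
      x→z = proj₁ (splitʷ pre wp)
      z→y : Walk z y (z ∷ reverse qpre)
      z→y = subst (Walk z y) (reverse-++ qpre [ z ]) (reverseʷ (proj₁ (splitʷ qpre wq)))
      cycle = (pre ∷ʳ z) ++ reverse qpre
      x→y : Walk x y cycle
      x→y = x→z ++ʷ z→y
      qpre⊆q : ∀ {v} → v ∈ reverse qpre → v ∈ q
      qpre⊆q v∈ = ∈-++⁺ˡ {xs = qpre} (reverse⁻ v∈)
      u-cycle : Unique cycle
      u-cycle = ++⁺ (Unique-prefix pre up)
                    (Unique-reverse (proj₁ (Unique-++⁻ qpre uq)))
                    λ { (v∈pre-z , v∈qpre) → disjoint (∈-++⁻ pre v∈pre-z) (reverse⁻ v∈qpre) }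
        where
          disjoint : ∀ {v} → v ∈ pre ⊎ v ∈ [ z ] → v ∈ qpre → ⊥
          disjoint (inj₁ v∈pre) v∈qpre = All.lookup pre∉q v∈pre (∈-++⁺ˡ v∈qpre)
          disjoint (inj₂ (here refl)) z∈qpre = proj₂ (proj₂ (Unique-++⁻ qpre uq)) (z∈qpre , here refl)
      a∉cycle : All (a ≢_) cycle
      a∉cycle = All.¬Any⇒All¬ cycle λ a∈ → case ∈-++⁻ (pre ∷ʳ z) a∈ of λ where
        (inj₁ a∈pre-z) → All.All¬⇒¬Any a∉p (∈-prefix pre a∈pre-z)
        (inj₂ a∈qpre) → All.All¬⇒¬Any a∉q (qpre⊆q a∈qpre)

  walk-unique : ∀ {a b p q} → Walk a b p → Unique p → Walk a b q → Unique q → p ≡ q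
  walk-unique end _ end _ = refl
  walk-unique end _ (_ ∷ w) (a∉ ∷ _) = ⊥-elim (All.All¬⇒¬Any a∉ (walk-end w) )
  walk-unique (_ ∷ w) (a∉ ∷ _) end _ = ⊥-elim (All.All¬⇒¬Any a∉ (walk-end w))
  walk-unique (ax ∷ wx) up@(_ ∷ up′) (ay ∷ wy) uq@(_ ∷ uq′)
    with refl ← second-vertex-unique ax ay wx up wy uq = cong (_ ∷_) (walk-unique wx up′ wy uq′)

  path : V → V → List V
  path a b = proj₁ (connected a b)

  path-IsPath : ∀ a b → IsPath E a b (path a b)
  path-IsPath a b = proj₂ (connected a b)

  path-walk : ∀ a b → Walk a b (path a b)
  path-walk a b = IsPath⇒Walk (path-IsPath a b)

  path-Unique : ∀ a b → Unique (path a b)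
  path-Unique a b = proj₁ (proj₂ (path-IsPath a b))

  path-unique : ∀ {a b xs} → Walk a b xs → Unique xs → xs ≡ path a b
  path-unique w u = walk-unique w u (path-walk _ _) (path-Unique _ _)

  IsPath⇒≡path : ∀ {a b xs} → IsPath E a b xs → xs ≡ path a b
  IsPath⇒≡path p = path-unique (IsPath⇒Walk p) (proj₁ (proj₂ p))

  ∉-IsPath⇒∉path : ∀ {a b xs t} → IsPath E a b xs → t ∉ xs → t ∉ path a b
  ∉-IsPath⇒∉path p = subst (_ ∉_) (IsPath⇒≡path p)

  path-start : ∀ a b → a ∈ path a b
  path-start a b = walk-start (path-walk a b)

  path-end : ∀ a b → b ∈ path a b
  path-end a b = walk-end (path-walk a b)

  path-self : ∀ a → path a a ≡ [ a ]
  path-self a = sym (path-unique end ([] ∷ []))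

  trivial-path : ∀ c → IsPath E c c [ c ]
  trivial-path c = Walk⇒IsPath end ([] ∷ [])

  path-cons : ∀ {a u b} → E a u → a ∉ path u b → path a b ≡ a ∷ path u b
  path-cons {u = u} {b} e a∉ = sym (path-unique (e ∷ path-walk u b) (All.¬Any⇒All¬ _ a∉ ∷ path-Unique u b))

  path-sym : ∀ a b → path b a ≡ reverse (path a b)
  path-sym a b = sym (path-unique (reverseʷ (path-walk a b)) (Unique-reverse (path-Unique a b)))

  ∈-path-sym : ∀ {a b t} → t ∈ path a b → t ∈ path b a
  ∈-path-sym {a} {b} t∈ = subst (_ ∈_) (sym (path-sym a b)) (reverse⁺ t∈)

  length-path-sym : ∀ a b → length (path a b) ≡ length (path b a)
  length-path-sym a b = trans (sym (length-reverse (path a b))) (cong length (sym (path-sym a b)))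

  path-split : ∀ {a b v} → v ∈ path a b → ∃₂ λ pre post →
               path a b ≡ pre ++ v ∷ post × path a v ≡ pre ∷ʳ v × path v b ≡ v ∷ post
  path-split {a} {b} {v} v∈ with ∈-∃++ v∈
  ... | pre , post , eq = pre , post , eq , sym (path-unique a→v (Unique-prefix pre u)) ,
                                         sym (path-unique v→b (proj₁ (proj₂ (Unique-++⁻ pre u))))
    where
      u : Unique (pre ++ v ∷ post)
      u = subst Unique eq (path-Unique a b)
      a→v : Walk a v (pre ∷ʳ v)
      a→v = proj₁ (splitʷ pre (subst (Walk a b) eq (path-walk a b)))
      v→b : Walk v b (v ∷ post)
      v→b = proj₂ (splitʷ pre (subst (Walk a b) eq (path-walk a b)))

  path-prefix-⊆ : ∀ {a b v t} → v ∈ path a b → t ∈ path a v → t ∈ path a b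
  path-prefix-⊆ v∈ t∈ with pre , post , ab≡ , av≡ , _ ← path-split v∈ =
    subst (_ ∈_) (sym ab≡) (∈-prefix pre (subst (_ ∈_) av≡ t∈))

  path-suffix-⊆ : ∀ {a b v t} → v ∈ path a b → t ∈ path v b → t ∈ path a b
  path-suffix-⊆ v∈ t∈ with pre , post , ab≡ , _ , vb≡ ← path-split v∈ =
    subst (_ ∈_) (sym ab≡) (∈-++⁺ʳ pre (subst (_ ∈_) vb≡ t∈))

  path-halves-meet : ∀ {a b v t} → v ∈ path a b → t ∈ path a v → t ∈ path v b → t ≡ v
  path-halves-meet {a} {b} v∈ t∈av t∈vb with pre , post , ab≡ , av≡ , vb≡ ← path-split v∈ =
    Unique-split pre (subst Unique ab≡ (path-Unique a b)) (subst (_ ∈_) av≡ t∈av) (subst (_ ∈_) vb≡ t∈vb)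

  ∉-path-from : ∀ {a b v} → v ∈ path a b → v ≢ a → a ∉ path v b
  ∉-path-from {a} v∈ v≢a a∈ = v≢a (sym (path-halves-meet v∈ (path-start a _) a∈))

  ∉-path-to : ∀ {a b v} → v ∈ path a b → v ≢ b → b ∉ path a v
  ∉-path-to {b = b} v∈ v≢b b∈ = v≢b (sym (path-halves-meet v∈ b∈ (path-end _ b)))

  length-path-prefix : ∀ {a b v} → v ∈ path a b → v ≢ b → length (path a v) < length (path a b)
  length-path-prefix {a} {b} {v} v∈ v≢b with path-split v∈
  ... | pre , post , ab≡ , av≡ , vb≡ = begin-strict
    length (path a v)                ≡⟨ cong length av≡ ⟩
    length (pre ∷ʳ v)                <⟨ m<m+n _ (post-nonempty post vb≡) ⟩
    length (pre ∷ʳ v) + length post  ≡⟨ length-++ (pre ∷ʳ v) ⟨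
    length ((pre ∷ʳ v) ++ post)      ≡⟨ cong length (trans (++-assoc pre [ v ] post) (sym ab≡)) ⟩
    length (path a b)                ∎
    where
      open Data.Nat.Properties.≤-Reasoning
      post-nonempty : ∀ post → path v b ≡ v ∷ post → 0 < length post
      post-nonempty [] vb≡ = ⊥-elim (v≢b (sym (singleton⁻ (subst (b ∈_) vb≡ (path-end v b)))))
      post-nonempty (_ ∷ _) _ = s≤s z≤n

  walk-covers-path : ∀ {a b xs t} → Walk a b xs → t ∈ path a b → t ∈ xs
  walk-covers-path {a} end t∈ = subst (_ ∈_) (path-self a) t∈
  walk-covers-path {a} {b} (_∷_ {b = u} e w) t∈ with a ∈? path u b
  ... | yes a∈ = there (walk-covers-path w (path-suffix-⊆ a∈ t∈))
  ... | no a∉ with subst (_ ∈_) (path-cons e a∉) t∈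
  ...   | here t≡a = here t≡a
  ...   | there t∈′ = there (walk-covers-path w t∈′)

  path-⊆-∪ : ∀ {a b c t} → t ∈ path a c → t ∈ path a b ⊎ t ∈ path b c
  path-⊆-∪ {a} {b} {c} t∈ with ys , bc≡ ← walk-head (path-walk b c) =
    Sum.map₂ (λ t∈ys → subst (_ ∈_) (sym bc≡) (there t∈ys))
      (∈-++⁻ (path a b) (walk-covers-path (path-walk a b ++ʷ subst (Walk b c) bc≡ (path-walk b c)) t∈))

  first-step : ∀ {a b} → a ≢ b → ∃ λ u → E a u × u ∈ path a b
  first-step {a} {b} a≢b = go (path-walk a b)
    where
      go : ∀ {xs} → Walk a b xs → ∃ λ u → E a u × u ∈ xs
      go end = ⊥-elim (a≢b refl)
      go (e ∷ w) = _ , e , there (walk-start w)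

  allPairs : List (V × V)
  allPairs = cartesianProduct (allFin m) (allFin m)

  ∈-allPairs : ∀ a b → (a , b) ∈ allPairs
  ∈-allPairs a b = ∈-cartesianProduct⁺ (∈-allFin a) (∈-allFin b)

  -- x lies in the component of T - v containing u iff v is not on the path from u to x.
  branch : V → V → VSet m
  branch v u = ⟦ (λ x → ¬? (v ∈? path u x)) ⟧

  ∈-branch⁺ : ∀ {v u x} → v ∉ path u x → branch v u x ≡ true
  ∈-branch⁺ = ∈⟦⟧⁺ (λ x → ¬? (_ ∈? path _ x))

  ∈-branch⁻ : ∀ {v u x} → branch v u x ≡ true → v ∉ path u x
  ∈-branch⁻ = ∈⟦⟧⁻ (λ x → ¬? (_ ∈? path _ x))

  ∉-branch⁻ : ∀ {v u x} → ∁ (branch v u) x ≡ true → v ∈ path u x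
  ∉-branch⁻ {v} {u} {x} x∉ = decidable-stable (v ∈? path u x) (∈⟦⟧⁻ (λ x → ¬? (¬? (v ∈? path u x))) x∉)

  branch-contains : ∀ {v u} → u ≢ v → branch v u u ≡ true
  branch-contains {v} {u} u≢v = ∈-branch⁺ λ v∈ → u≢v (sym (singleton⁻ (subst (v ∈_) (path-self u) v∈)))

  branch-avoids : ∀ v u → branch v u v ≡ false
  branch-avoids v u = dec-false (¬? (v ∈? path u v)) (λ v∉ → v∉ (path-end u v))

  branch-⊆ : ∀ {a y z} → a ∉ path y z → branch a y ⊆ branch a z
  branch-⊆ a∉yz x x∈ = ∈-branch⁺ (Sum.[ a∉yz ∘ ∈-path-sym , ∈-branch⁻ x∈ ] ∘ path-⊆-∪)

  branch-toward : ∀ {v u y} → u ∈ path v y → u ≢ v → ∀ x → branch v u x ≡ branch v y x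
  branch-toward u∈ u≢v x = ⇔→≡ (mk⇔ (branch-⊆ (λ v∈uy → ∉-path-from u∈ u≢v v∈uy) x)
                                     (branch-⊆ (λ v∈yu → ∉-path-from u∈ u≢v (∈-path-sym v∈yu)) x))

  branch-⊆-farther : ∀ {u v z} → u ∈ path z v → branch u z ⊆ branch v z
  branch-⊆-farther u∈zv x x∈ = ∈-branch⁺ λ v∈zx → ∈-branch⁻ x∈ (path-prefix-⊆ v∈zx u∈zv)

  branches-cover : ∀ {a b} → a ≢ b → ∀ x → branch a b x ≡ true ⊎ branch b a x ≡ true
  branches-cover {a} {b} a≢b x = case b ∈? path a x of λ where
    (yes b∈) → inj₁ (∈-branch⁺ (∉-path-from b∈ (a≢b ∘ sym)))
    (no b∉) → inj₂ (∈-branch⁺ b∉)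

  adjacent-branches-disjoint : ∀ {u v} → E u v → ∀ x → branch u v x ≡ true → branch v u x ≡ true → ⊥
  adjacent-branches-disjoint {u} {v} e x u∉ v∉ =
    ∈-branch⁻ v∉ (subst (v ∈_) (sym (path-cons e (∈-branch⁻ u∉))) (there (path-start v x)))

  ∁branch-⊆ : ∀ {a b c} → a ≢ c → a ∉ path b c → ∁ (branch a b) ⊆ branch c a
  ∁branch-⊆ a≢c a∉bc x x∉ =
    ∈-branch⁺ (Sum.[ ⊥-elim ∘ a∉bc , (λ a∈cx → ∉-path-from a∈cx a≢c) ] (path-⊆-∪ (∉-branch⁻ x∉)))

  ∁branches-disjoint : ∀ {a b} → a ≢ b → ∀ x → ∁ (branch a b) x ≡ true → ∁ (branch b a) x ≡ true → ⊥
  ∁branches-disjoint a≢b x a∈bx b∈ax = ∉-path-from (∉-branch⁻ a∈bx) a≢b (∉-branch⁻ b∈ax)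

  branch-IsSubtreeOf : ∀ {v u} → u ≢ v → IsSubtreeOf E v u (branch v u)
  branch-IsSubtreeOf {v} {u} u≢v = u≢v , λ x →
    (λ x∈ → path u x , path-IsPath u x , ∈-branch⁻ x∈) ,
    (λ { (xs , p , v∉xs) → ∈-branch⁺ (∉-IsPath⇒∉path p v∉xs) })

  IsSubtreeOf⇒≗branch : ∀ {v u S} → IsSubtreeOf E v u S → ∀ x → S x ≡ branch v u x
  IsSubtreeOf⇒≗branch (u≢v , S↔) x with branch-IsSubtreeOf u≢v
  ... | _ , branch↔ =
    ⇔→≡ (mk⇔ (proj₂ (branch↔ x) ∘ proj₁ (S↔ x)) (proj₂ (S↔ x) ∘ proj₁ (branch↔ x)))

  PathMeetsOnlyAt : List V → V → V → Set
  PathMeetsOnlyAt P v x = All (λ y → y ∈ P → y ≡ v) (path v x)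

  pathMeetsOnlyAt? : ∀ P v → Decidable (PathMeetsOnlyAt P v)
  pathMeetsOnlyAt? P v x = All.all? (λ y → (y ∈? P) →-dec (y ≟ v)) (path v x)

  Tᵥ : List V → V → VSet m
  Tᵥ P v = ⟦ pathMeetsOnlyAt? P v ⟧

  Tᵥ-IsTvP : ∀ P v → IsTvP E P v (Tᵥ P v)
  Tᵥ-IsTvP P v x =
    (λ x∈ → path v x , path-IsPath v x , λ y y∈ → All.lookup (∈⟦⟧⁻ (pathMeetsOnlyAt? P v) x∈) y∈) ,
    (λ { (xs , p , avoids) → ∈⟦⟧⁺ (pathMeetsOnlyAt? P v)
                               (All.tabulate λ {y} y∈ → avoids y (subst (y ∈_) (sym (IsPath⇒≡path p)) y∈)) })

  Tᵥ-⊆ : ∀ {P a b} → b ∈ P → b ≢ a → Tᵥ P a ⊆ branch b a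
  Tᵥ-⊆ {P} {a} b∈P b≢a x x∈ =
    ∈-branch⁺ λ b∈ax → b≢a (All.lookup (∈⟦⟧⁻ (pathMeetsOnlyAt? P a) x∈) b∈ax b∈P)

  ∁Tᵥ-⊆ : ∀ {P a b} → (∀ {y} → y ∈ P → y ≢ a → a ∉ path b y) → ∁ (Tᵥ P a) ⊆ branch a b
  ∁Tᵥ-⊆ {P} {a} P-beyond x x∉
    with find (All.¬All⇒Any¬ (λ y → (y ∈? P) →-dec (y ≟ a)) (path a x)
                             (∈⟦⟧⁻ (¬? ∘ pathMeetsOnlyAt? P a) x∉))
  ... | y , y∈ax , ¬[y∈P→y≡a] =
    ∈-branch⁺ (Sum.[ P-beyond y∈P y≢a , ∉-path-from y∈ax y≢a ] ∘ path-⊆-∪)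
    where
      y≢a : y ≢ a
      y≢a y≡a = ¬[y∈P→y≡a] λ _ → y≡a
      y∈P : y ∈ P
      y∈P = decidable-stable (y ∈? P) λ y∉P → ¬[y∈P→y≡a] (⊥-elim ∘ y∉P)

  ReachedFromInterior : List V → V → V → V → Set
  ReachedFromInterior P c₁ c₂ x = Any (λ i → i ≢ c₁ × i ≢ c₂ × c₁ ∉ path i x × c₂ ∉ path i x) P

  reachedFromInterior? : ∀ P c₁ c₂ → Decidable (ReachedFromInterior P c₁ c₂)
  reachedFromInterior? P c₁ c₂ x =
    Any.any? (λ i → ¬? (i ≟ c₁) ×-dec ¬? (i ≟ c₂) ×-dec
                    ¬? (c₁ ∈? path i x) ×-dec ¬? (c₂ ∈? path i x)) P

  Tₚ : List V → V → V → VSet m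
  Tₚ P c₁ c₂ = ⟦ reachedFromInterior? P c₁ c₂ ⟧

  Tₚ-IsTP : ∀ P c₁ c₂ → IsTP E P c₁ c₂ (Tₚ P c₁ c₂)
  Tₚ-IsTP P c₁ c₂ x =
    (λ x∈ → let i , i∈ , i≢c₁ , i≢c₂ , c₁∉ , c₂∉ = find (∈⟦⟧⁻ (reachedFromInterior? P c₁ c₂) x∈)
            in i , i∈ , i≢c₁ , i≢c₂ , path i x , path-IsPath i x , c₁∉ , c₂∉) ,
    (λ { (i , i∈ , i≢c₁ , i≢c₂ , xs , p , c₁∉ , c₂∉) →
         ∈⟦⟧⁺ (reachedFromInterior? P c₁ c₂)
              (lose i∈ (i≢c₁ , i≢c₂ , ∉-IsPath⇒∉path p c₁∉ , ∉-IsPath⇒∉path p c₂∉)) })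

  Tₚ-⊆ : ∀ c₁ c₂ → Tₚ (path c₁ c₂) c₁ c₂ ⊆ branch c₁ c₂ ∩ branch c₂ c₁
  Tₚ-⊆ c₁ c₂ x x∈ with find (∈⟦⟧⁻ (reachedFromInterior? _ c₁ c₂) x∈)
  ... | i , i∈ , i≢c₁ , i≢c₂ , c₁∉ix , c₂∉ix = ∩-intro {S = branch c₁ c₂} {branch c₂ c₁}
    (∈-branch⁺ (Sum.[ ∉-path-from i∈ i≢c₁ ∘ ∈-path-sym , c₁∉ix ] ∘ path-⊆-∪))
    (∈-branch⁺ (Sum.[ ∉-path-to i∈ i≢c₂ , c₂∉ix ] ∘ path-⊆-∪))

  module Weighted (w : V → ℕ) where
    open Weight w

    n : ℕ
    n = totalWeight w

    branchWeight : V → V → ℕ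
    branchWeight v u = weight w (branch v u)

    n≤branchWeight+branchWeight : ∀ {a b} → a ≢ b → n ≤ branchWeight a b + branchWeight b a
    n≤branchWeight+branchWeight a≢b =
      ≤-trans (m≤m+n n _) (≤-reflexive (sym (weight-covering (branches-cover a≢b))))

    adjacent-branchWeight : ∀ {a b} → E a b → branchWeight a b + branchWeight b a ≤ n
    adjacent-branchWeight e =
      ≤-trans (≤-reflexive (weight-disjoint-∪ (adjacent-branches-disjoint e))) (weight-mono (λ _ _ → refl))

    heaviest-branch : ∀ v → Σ ℕ λ h → (∀ {u} → u ≢ v → branchWeight v u ≤ h)
                                    × ((∃ λ u → u ≢ v × branchWeight v u ≡ h) ⊎ ((∀ u → u ≡ v) × h ≡ 0))
    heaviest-branch v
      with extremum (Flip.totalPreorder ≤-totalPreorder) (branchWeight v) (λ u → ¬? (u ≟ v)) (allFin m)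
    ... | inj₁ (u , u≢v , heaviest) =
      branchWeight v u , (λ {u′} → heaviest (∈-allFin u′)) , inj₁ (u , u≢v , refl)
    ... | inj₂ none = 0 , (λ {u} u≢v → ⊥-elim (none (∈-allFin u) u≢v)) ,
                      inj₂ ((λ u → decidable-stable (u ≟ v) (none (∈-allFin u))) , refl)

    hs : V → ℕ
    hs v = proj₁ (heaviest-branch v)

    branchWeight≤hs : ∀ {u v} → u ≢ v → branchWeight v u ≤ hs v
    branchWeight≤hs = proj₁ (proj₂ (heaviest-branch _))

    hs-attained : ∀ v → (∃ λ u → u ≢ v × branchWeight v u ≡ hs v) ⊎ ((∀ u → u ≡ v) × hs v ≡ 0)
    hs-attained v = proj₂ (proj₂ (heaviest-branch v))

    HS-hs : ∀ v → HS E w v (hs v)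
    HS-hs v = (λ u S sub → ≤-trans (≤-reflexive (weight-cong (IsSubtreeOf⇒≗branch sub)))
                                   (branchWeight≤hs (proj₁ sub))) ,
              Sum.map₁ (λ (u , u≢v , eq) → u , branch v u , branch-IsSubtreeOf u≢v , eq) (hs-attained v)

    HS⇒≡hs : ∀ {v h} → HS E w v h → h ≡ hs v
    HS⇒≡hs {v} {h} (bounded , attained) = ≤-antisym h≤hs hs≤h
      where
        h≤hs : h ≤ hs v
        h≤hs = Sum.[ (λ (u , S , sub , eq) →
                        ≤-trans (≤-reflexive (trans (sym eq) (weight-cong (IsSubtreeOf⇒≗branch sub))))
                                (branchWeight≤hs (proj₁ sub)))
                   , (λ (_ , h≡0) → ≤-trans (≤-reflexive h≡0) z≤n) ]′ attained
        hs≤h : hs v ≤ h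
        hs≤h = Sum.[ (λ (u , u≢v , eq) →
                        ≤-trans (≤-reflexive (sym eq)) (bounded u (branch v u) (branch-IsSubtreeOf u≢v)))
                   , (λ (_ , hs≡0) → ≤-trans (≤-reflexive hs≡0) z≤n) ]′ (hs-attained v)

    centroid-minimal : ∀ {c} → IsCentroid E w c → ∀ v → hs c ≤ hs v
    centroid-minimal (h , HS-h , minimal) v = ≤-trans (≤-reflexive (sym (HS⇒≡hs HS-h))) (minimal v (hs v) (HS-hs v))

    n≤hs+hs : ∀ {v c} → v ≢ c → n ≤ hs v + hs c
    n≤hs+hs v≢c = ≤-trans (n≤branchWeight+branchWeight v≢c)
                          (+-mono-≤ (branchWeight≤hs (v≢c ∘ sym)) (branchWeight≤hs v≢c))

    Balanced : V → Set
    Balanced c = ∀ z → z ≢ c → 2 * branchWeight c z ≤ n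

    balanced⇒hs : ∀ {c} → Balanced c → 2 * hs c ≤ n
    balanced⇒hs {c} balanced =
      Sum.[ (λ (u , u≢c , bw≡hs) → ≤-trans (≤-reflexive (cong (2 *_) (sym bw≡hs))) (balanced u u≢c))
          , (λ (_ , hs≡0) → ≤-trans (≤-reflexive (cong (2 *_) hs≡0)) z≤n) ]′ (hs-attained c)

    neighbour-branch : ∀ {v u z} → E v u → z ≢ u →
                       branchWeight u z + branchWeight v u ≤ n ⊎ branch u z ⊆ branch v u
    neighbour-branch {v} {u} {z} e z≢u with u ∈? path z v
    ... | no u∉zv =
      inj₁ (≤-trans (+-monoˡ-≤ _ (weight-mono (branch-⊆ u∉zv))) (adjacent-branchWeight (symmetric e)))
    ... | yes u∈zv = inj₂ λ x x∈ → branch-⊆ (∉-path-to u∈zv u≢v) x (branch-⊆-farther u∈zv x x∈)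
      where
        u≢v : u ≢ v
        u≢v refl = irreflexive v e

    -- Among the pairs (v , y) whose branch is heavier than n/2, take one whose branch has the fewest
    -- vertices; the neighbour of v towards y is then balanced.
    balanced-exists : V → ∃ Balanced
    balanced-exists v₀
      with extremum ≤-totalPreorder (λ (v , y) → weight (λ _ → 1) (branch v y))
                    (λ (v , y) → ¬? (y ≟ v) ×-dec (n <? 2 * branchWeight v y)) allPairs
    ... | inj₂ none = v₀ , λ z z≢v₀ → ≮⇒≥ λ heavy → none (∈-allPairs v₀ z) (z≢v₀ , heavy)
    ... | inj₁ ((v , y) , (y≢v , heavy) , fewest) with first-step (y≢v ∘ sym)
    ... | u , e , u∈ = u , λ z z≢u → ≮⇒≥ λ heavy-uz →
      Sum.[ (λ sum≤n → <⇒≱ (Halving.half-< {b = branchWeight v u} sum≤n heavy-vu) (<⇒≤ heavy-uz))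
          , (λ uz⊆vu → <⇒≱ (fewer uz⊆vu) (fewest (∈-allPairs u z) (z≢u , heavy-uz))) ]′
          (neighbour-branch e z≢u)
      where
        u≢v : u ≢ v
        u≢v refl = irreflexive v e
        heavy-vu : n < 2 * branchWeight v u
        heavy-vu = subst (λ k → n < 2 * k) (sym (weight-cong (branch-toward u∈ u≢v))) heavy
        fewer : ∀ {z} → branch u z ⊆ branch v u →
                weight (λ _ → 1) (branch u z) < weight (λ _ → 1) (branch v y)
        fewer {z} uz⊆vu = subst (_ <_) (Weight.weight-cong (λ _ → 1) (branch-toward u∈ u≢v))
          (Weight.weight-⊂ (λ _ → 1) u uz⊆vu (branch-contains u≢v) (branch-avoids u z) (s≤s z≤n))

    n≤2hs : ∀ {c v} → 2 * hs c ≤ n → v ≢ c → n ≤ 2 * hs v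
    n≤2hs {c} 2hs≤n v≢c = Halving.≤-half {b = hs c} (n≤hs+hs v≢c) 2hs≤n

    unique-centroid : ∀ {c c′} → 2 * hs c < n → IsCentroid E w c′ → c′ ≡ c
    unique-centroid {c} {c′} 2hs<n centroid = decidable-stable (c′ ≟ c) λ c′≢c →
      <⇒≱ 2hs<n (≤-trans (n≤2hs (<⇒≤ 2hs<n) c′≢c) (*-monoʳ-≤ 2 (centroid-minimal centroid c)))

    T-trivial-weightless : ∀ c → ∃ λ S → IsTP E [ c ] c c S × weight w S ≡ 0
    T-trivial-weightless c =
      (λ _ → false) ,
      (λ x → (λ ()) , λ { (_ , here refl , c≢c , _) → ⊥-elim (c≢c refl) }) ,
      weight-∅ (λ _ → refl)

    Half : V → Set
    Half v = 2 * hs v ≡ n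

    centroid⇒half : ∀ {c c′} → Half c → IsCentroid E w c′ → Half c′
    centroid⇒half {c} {c′} half centroid with c′ ≟ c
    ... | yes refl = half
    ... | no c′≢c = ≤-antisym (≤-trans (*-monoʳ-≤ 2 (centroid-minimal centroid c)) (≤-reflexive half))
                              (n≤2hs (≤-reflexive half) c′≢c)

    half⇒branchWeight : ∀ {u v} → u ≢ v → Half v → 2 * branchWeight v u ≤ n
    half⇒branchWeight u≢v half = ≤-trans (*-monoʳ-≤ 2 (branchWeight≤hs u≢v)) (≤-reflexive half)

    half-pair-branchWeight : ∀ {a b} → a ≢ b → Half a → Half b → 2 * branchWeight a b ≡ n
    half-pair-branchWeight {a} {b} a≢b half-a half-b = ≤-antisym (half⇒branchWeight (a≢b ∘ sym) half-a)
      (Halving.≤-half {b = branchWeight b a} (n≤branchWeight+branchWeight a≢b) (half⇒branchWeight a≢b half-b))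

    half-neighbour : ∀ {c} → Half c → 0 < n → ∃ λ u → u ≢ c × Half u
    half-neighbour {c} half n>0 with hs-attained c
    ... | inj₂ (_ , hs≡0) = ⊥-elim (<⇒≱ n>0 (≤-reflexive (trans (sym half) (cong (2 *_) hs≡0))))
    ... | inj₁ (y , y≢c , bw≡hs) with first-step (y≢c ∘ sym)
    ... | u , e , u∈ = u , u≢c , ≤-antisym (balanced⇒hs balanced) (n≤2hs (≤-reflexive half) u≢c)
      where
        u≢c : u ≢ c
        u≢c refl = irreflexive c e
        2bw≡n : 2 * branchWeight c u ≡ n
        2bw≡n = trans (cong (2 *_) (trans (weight-cong (branch-toward u∈ u≢c)) bw≡hs)) half
        balanced : Balanced u
        balanced z z≢u =
          Sum.[ (λ sum≤n → Halving.half-≤ {b = branchWeight c u} sum≤n (≤-reflexive (sym 2bw≡n)))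
              , (λ uz⊆cu → ≤-trans (*-monoʳ-≤ 2 (weight-mono uz⊆cu)) (≤-reflexive 2bw≡n)) ]′
              (neighbour-branch e z≢u)

    half? : ∀ v → Dec (Half v)
    half? v = 2 * hs v ℕ.≟ n

    Farthest : V → V → Set
    Farthest c₁ c₂ = c₁ ≢ c₂ × Half c₁ × Half c₂
                   × (∀ {a b} → a ≢ b → Half a → Half b → length (path a b) ≤ length (path c₁ c₂))

    farthest-exists : ∀ {c} → Half c → 0 < n → ∃₂ Farthest
    farthest-exists half n>0
      with extremum (Flip.totalPreorder ≤-totalPreorder) (λ (a , b) → length (path a b))
                    (λ (a , b) → ¬? (a ≟ b) ×-dec half? a ×-dec half? b) allPairs
    ... | inj₂ none = let u , u≢c , half-u = half-neighbour half n>0 in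
                      ⊥-elim (none (∈-allPairs _ _) (u≢c , half-u , half))
    ... | inj₁ ((c₁ , c₂) , (c₁≢c₂ , half₁ , half₂) , farthest) =
      c₁ , c₂ , c₁≢c₂ , half₁ , half₂ ,
      λ a≢b half-a half-b → farthest (∈-allPairs _ _) (a≢b , half-a , half-b)

    -- If c were off the path, maximality would keep c₁ and c₂ off the paths to c, and then the two
    -- halves of the tree lying beyond c₁ and beyond c₂ would both lie in one branch of c.
    half⇒∈path : ∀ {c₁ c₂ c} → Farthest c₁ c₂ → 0 < n → Half c → c ∈ path c₁ c₂
    half⇒∈path {c₁} {c₂} {c} (c₁≢c₂ , half₁ , half₂ , farthest) n>0 half =
      decidable-stable (c ∈? path c₁ c₂) λ c∉ → Halving.more-than-half n>0 (n≤hs c∉) half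
      where
        open Data.Nat.Properties.≤-Reasoning
        beyond-half : ∀ {a b} → a ≢ b → Half a → Half b → 2 * weight w (∁ (branch a b)) ≡ n
        beyond-half {a} {b} a≢b half-a half-b = Halving.other-half {a = branchWeight a b}
          (weight-∁ (branch a b)) (half-pair-branchWeight a≢b half-a half-b)
        n≤hs : c ∉ path c₁ c₂ → n ≤ hs c
        n≤hs c∉ = begin
          n                                               ≡⟨ Halving.halves-sum {a = weight w (∁ (branch c₁ c₂))}
                                                               (beyond-half c₁≢c₂ half₁ half₂)
                                                               (beyond-half (c₁≢c₂ ∘ sym) half₂ half₁) ⟨
          weight w (∁ (branch c₁ c₂)) + weight w (∁ (branch c₂ c₁))
                                                          ≡⟨ weight-disjoint-∪ (∁branches-disjoint c₁≢c₂) ⟩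
          weight w (∁ (branch c₁ c₂) ∪ ∁ (branch c₂ c₁))  ≤⟨ weight-mono (∪-⊆ beyond₁⊆ beyond₂⊆) ⟩
          branchWeight c c₁                               ≤⟨ branchWeight≤hs c₁≢c ⟩
          hs c                                            ∎
          where
            c₁≢c : c₁ ≢ c
            c₁≢c refl = c∉ (path-start c₁ c₂)
            c₂≢c : c₂ ≢ c
            c₂≢c refl = c∉ (path-end c₁ c₂)
            c₁∉c₂c : c₁ ∉ path c₂ c
            c₁∉c₂c c₁∈ = <⇒≱ (begin-strict
              length (path c₁ c₂)  ≡⟨ length-path-sym c₁ c₂ ⟩
              length (path c₂ c₁)  <⟨ length-path-prefix c₁∈ c₁≢c ⟩
              length (path c₂ c)   ∎) (farthest c₂≢c half₂ half)
            c₂∉c₁c : c₂ ∉ path c₁ c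
            c₂∉c₁c c₂∈ = <⇒≱ (length-path-prefix c₂∈ c₂≢c) (farthest c₁≢c half₁ half)
            beyond₁⊆ : ∁ (branch c₁ c₂) ⊆ branch c c₁
            beyond₁⊆ = ∁branch-⊆ c₁≢c c₁∉c₂c
            beyond₂⊆ : ∁ (branch c₂ c₁) ⊆ branch c c₁
            beyond₂⊆ x x∈ = branch-⊆ (c∉ ∘ ∈-path-sym) x (∁branch-⊆ c₂≢c c₂∉c₁c x x∈)

    Tᵥ-half : ∀ {P a b} → a ≢ b → b ∈ P → (∀ {y} → y ∈ P → y ≢ a → a ∉ path b y) →
              Half a → Half b → 2 * weight w (Tᵥ P a) ≡ n
    Tᵥ-half {P} {a} {b} a≢b b∈P P-beyond half-a half-b =
      trans (cong (2 *_) Tᵥ≡branch) (half-pair-branchWeight (a≢b ∘ sym) half-b half-a)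
      where
        Tᵥ≡branch : weight w (Tᵥ P a) ≡ branchWeight b a
        Tᵥ≡branch = Halving.+-squeeze
          (trans (weight-∁ (Tᵥ P a)) (sym (Halving.halves-sum {a = branchWeight b a} {branchWeight a b}
                                                               (half-pair-branchWeight (a≢b ∘ sym) half-b half-a)
                                                               (half-pair-branchWeight a≢b half-a half-b))))
          (weight-mono (Tᵥ-⊆ b∈P (a≢b ∘ sym))) (weight-mono (∁Tᵥ-⊆ P-beyond))

    T-interior-weightless : ∀ {c₁ c₂} → c₁ ≢ c₂ → Half c₁ → Half c₂ →
                            ∃ λ S → IsTP E (path c₁ c₂) c₁ c₂ S × weight w S ≡ 0
    T-interior-weightless {c₁} {c₂} c₁≢c₂ half₁ half₂ =
      Tₚ (path c₁ c₂) c₁ c₂ , Tₚ-IsTP (path c₁ c₂) c₁ c₂ ,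
      n≤0⇒n≡0 (≤-trans (weight-mono (Tₚ-⊆ c₁ c₂)) (≤-reflexive overlap≡0))
      where
        overlap≡0 : weight w (branch c₁ c₂ ∩ branch c₂ c₁) ≡ 0
        overlap≡0 = +-cancelˡ-≡ n _ 0 (begin-equality
          n + weight w (branch c₁ c₂ ∩ branch c₂ c₁)  ≡⟨ weight-covering (branches-cover c₁≢c₂) ⟨
          branchWeight c₁ c₂ + branchWeight c₂ c₁      ≡⟨ Halving.halves-sum {a = branchWeight c₁ c₂}
                                                            (half-pair-branchWeight c₁≢c₂ half₁ half₂)
                                                            (half-pair-branchWeight (c₁≢c₂ ∘ sym) half₂ half₁) ⟩
          n                                            ≡⟨ +-identityʳ n ⟨
          n + 0                                        ∎)
          where open Data.Nat.Properties.≤-Reasoning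

    T-start-half : ∀ {c₁ c₂} → c₁ ≢ c₂ → Half c₁ → Half c₂ →
                   ∃ λ S → IsTvP E (path c₁ c₂) c₁ S × 2 * weight w S ≡ n
    T-start-half {c₁} {c₂} c₁≢c₂ half₁ half₂ =
      Tᵥ (path c₁ c₂) c₁ , Tᵥ-IsTvP (path c₁ c₂) c₁ ,
      Tᵥ-half c₁≢c₂ (path-end c₁ c₂) (λ y∈ y≢c₁ → ∉-path-from y∈ y≢c₁ ∘ ∈-path-sym)
              half₁ half₂

    T-end-half : ∀ {c₁ c₂} → c₁ ≢ c₂ → Half c₁ → Half c₂ →
                 ∃ λ S → IsTvP E (path c₁ c₂) c₂ S × 2 * weight w S ≡ n
    T-end-half {c₁} {c₂} c₁≢c₂ half₁ half₂ =
      Tᵥ (path c₁ c₂) c₂ , Tᵥ-IsTvP (path c₁ c₂) c₂ ,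
      Tᵥ-half (c₁≢c₂ ∘ sym) (path-start c₁ c₂) (λ y∈ y≢c₂ → ∉-path-to y∈ y≢c₂) half₂ half₁

theorem3 : ∀ {m} (E : Fin m → Fin m → Set) (w : Fin m → ℕ) → IsTree E
    → (∃[ v ] (0 < w v)) → (n : ℕ) → totalWeight w ≡ n
    → ∃[ c₁ ] ∃[ c₂ ] ∃[ P ]
        ( IsPath E c₁ c₂ P
        × (∀ c → IsCentroid E w c → c ∈ P)
        × (∃[ S ] (IsTP E P c₁ c₂ S × weight w S ≡ 0))
        × ( ( c₁ ≢ c₂
            × (∃[ h ] (HS E w c₁ h × 2 * h ≡ n))
            × (∃[ h ] (HS E w c₂ h × 2 * h ≡ n))
            × (∃[ S ] (IsTvP E P c₁ S × 2 * weight w S ≡ n))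
            × (∃[ S ] (IsTvP E P c₂ S × 2 * weight w S ≡ n)) )
          ⊎ ( c₁ ≡ c₂ × P ≡ c₁ ∷ [] × (∃[ h ] (HS E w c₁ h × 2 * h < n)) ) ) )
theorem3 E w tree (v₀ , w₀>0) _ refl =
  let open Tree tree
      open Weighted w
      c , balanced = balanced-exists v₀
      n>0 = Weight.totalWeight-positive w w₀>0
  in case m≤n⇒m<n∨m≡n (balanced⇒hs balanced) of λ where
    (inj₁ 2hs<n) →
      c , c , [ c ] , trivial-path c , (λ c′ centroid → here (unique-centroid 2hs<n centroid)) ,
      T-trivial-weightless c , inj₂ (refl , refl , hs c , HS-hs c , 2hs<n)
    (inj₂ half) →
      let c₁ , c₂ , farthest@(c₁≢c₂ , half₁ , half₂ , _) = farthest-exists half n>0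
      in c₁ , c₂ , path c₁ c₂ , path-IsPath c₁ c₂ ,
         (λ c′ centroid → half⇒∈path farthest n>0 (centroid⇒half half centroid)) ,
         T-interior-weightless c₁≢c₂ half₁ half₂ ,
         inj₁ (c₁≢c₂ , (hs c₁ , HS-hs c₁ , half₁) , (hs c₂ , HS-hs c₂ , half₂) ,
               T-start-half c₁≢c₂ half₁ half₂ , T-end-half c₁≢c₂ half₁ half₂)
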